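{- Let $n$ be a positive integer and let $k\in\mathcal{R}(n,1)$. Then there exist an integer $t$ with $0\le t\le n/2$ and an integer $h$ with $0\le h\le C_t$ such that $k=\sum_{r=1}^{h} p_r$, where for each $r$ there are an integer $j_r$ with $1\le j_r\le t+1$ and non-negative integers $s_{r,1},\dots,s_{r,j_r}$ with $s_{r,1}+\cdots+s_{r,j_r}=n-t$ and $p_r=\prod_{i=1}^{j_r} C_{s_{r,i}}$.
   Context: $C_i=\frac{1}{i+1}\binom{2i}{i}$ is the $i$-th Catalan number. Consider words over the alphabet $\{A,\overline{A}\}$, where $A$ and $\overline{A}$ are complements. A plane tree is a rooted tree embedded in the plane with root on top, children ordered left to right; its half edges are ordered by starting at the root and tracing the perimeter counterclockwise, touching each side of each edge once. For a word $w=w[1]\cdots w[2n]$ and plane tree $T$ with $n$ edges, label the $i$-th half edge by $w[i]$; $T$ is $w$-valid if the two labels of every edge are complements. $\mathcal{R}(n,1)$ is the set of integers $k\ge 0$ such that some word of length $2n$ over $\{A,\overline{A}\}$ has exactly $k$ valid plane trees. -}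

module Defs where

open import Data.Nat using (ℕ; zero; suc; _+_; _*_; _∸_; _≤_)
open import Data.Nat.DivMod using (_/_)
open import Data.Nat.Combinatorics using (_C_)
open import Data.Bool using (Bool; true; false; if_then_else_)
open import Data.List using (List; []; _∷_; length; map)
open import Data.Nat.ListAction using (sum)
open import Data.Vec using (Vec; toList)
open import Data.Maybe using (Maybe; just; nothing)
open import Data.Product using (Σ; _×_; ∃-syntax)
open import Data.List.Membership.Propositional using (_∈_)
open import Data.List.Relation.Unary.Unique.Propositional using (Unique)
open import Function.Bundles using (_⇔_)
open import Relation.Binary.PropositionalEquality using (_≡_)

catalan : ℕ → ℕ
catalan i = ((2 * i) C i) / suc i

data Letter : Set where
  A Ā : Letter

isComp : Letter → Letter → Bool
isComp A Ā = true
isComp Ā A = true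
isComp _ _ = false

data PlaneTree : Set where
  node : List PlaneTree → PlaneTree

mutual
  edges : PlaneTree → ℕ
  edges (node ts) = edgesF ts

  edgesF : List PlaneTree → ℕ
  edgesF [] = 0
  edgesF (t ∷ ts) = suc (edges t + edgesF ts)

-- Reading the word along the perimeter walk from the root (leftmost child
-- first): each edge to a child t consumes one letter going down, then the
-- letters of the subtree t, then one letter going up; the two letters of the
-- edge must be complements.
mutual
  vTree : PlaneTree → List Letter → Maybe (List Letter)
  vTree (node ts) w = vForest ts w

  vForest : List PlaneTree → List Letter → Maybe (List Letter)
  vForest [] w = just w
  vForest (t ∷ ts) [] = nothing
  vForest (t ∷ ts) (a ∷ w) with vTree t w
  ... | nothing = nothing
  ... | just [] = nothing
  ... | just (b ∷ w') = if isComp a b then vForest ts w' else nothing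

Valid : (n : ℕ) → Vec Letter (2 * n) → PlaneTree → Set
Valid n w T = vTree T (toList w) ≡ just []

HasExactlyValid : (n : ℕ) → Vec Letter (2 * n) → ℕ → Set
HasExactlyValid n w k =
  Σ (List PlaneTree) λ L →
    length L ≡ k × Unique L × (∀ T → (T ∈ L) ⇔ (edges T ≡ n × Valid n w T))

InR1 : ℕ → ℕ → Set
InR1 n k = ∃[ w ] HasExactlyValid n w k

prod : List ℕ → ℕ
prod [] = 1
prod (x ∷ xs) = x * prod xs

catProd : ∀ {j} → Vec ℕ j → ℕ
catProd s = prod (map catalan (toList s))

vsum : ∀ {j} → Vec ℕ j → ℕ
vsum s = sum (toList s)

module Submission where

-- A w-valid plane tree is a non-crossing perfect matching of the 2n positions of w (the two sides of
-- each edge) in which matched letters are complementary, so k counts these matchings.  Matched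
-- positions are an odd distance apart, so flipping every other letter turns "complementary" into
-- "equal", and one of the two ways of flipping leaves a ≤ n letters A.  A matching of equal letters
-- is a non-crossing matching of the A's, in at most C_t ways for t = ⌊a/2⌋, together with a matching
-- of the Ā's inside each of the t + 1 regions cut out by the A-arcs; a region of size 2s can be matched
-- in C_s ways and one of odd size in none.  That 2s points have C_s non-crossing perfect matchings
-- follows from the ballot formula.

open import Defs
open import Algebra.Properties.CommutativeSemigroup as CommSemigroupProperties using ()
open import Data.Bool using (true)
open import Data.Empty using (⊥-elim)
open import Data.List using (List; []; _∷_; length; map; _++_; replicate; filter; cartesianProductWith)
open import Data.List.Membership.Propositional using (_∈_)
open import Data.List.Membership.Propositional.Properties
  using (∈-++⁺ˡ; ∈-++⁺ʳ; ∈-++⁻; ∈-map⁺; ∈-map⁻; ∈-cartesianProductWith⁺; ∈-cartesianProductWith⁻)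
open import Data.List.Membership.Propositional.Properties.WithK using (unique∧set⇒bag)
open import Data.List.Properties
  using (length-++; length-++-≤ˡ; length-++-≤ʳ; length-map; length-filter; length-replicate; ++-assoc;
         ++-identityʳ; ∷-injectiveʳ; map-++; map-∘; map-cong; map-cong-local)
open import Data.List.Relation.Binary.BagAndSetEquality using (∼bag⇒↭)
open import Data.List.Relation.Binary.Permutation.Propositional.Properties using (↭-length)
open import Data.List.Relation.Unary.All using (All; []; _∷_)
import Data.List.Relation.Unary.All as All
import Data.List.Relation.Unary.All.Properties as All
open import Data.List.Relation.Unary.AllPairs using ([]; _∷_)
open import Data.List.Relation.Unary.Any using (Any; here; there)
open import Data.List.Relation.Unary.Unique.Propositional using (Unique)
import Data.List.Relation.Unary.Unique.Propositional.Properties as Unique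
open import Data.Maybe using (just)
open import Data.Maybe.Properties using (just-injective)
open import Data.Nat
open import Data.Nat.Combinatorics using (_C_; nCk+nC[k+1]≡[n+1]C[k+1]; k>n⇒nCk≡0; nCk≡nC[n∸k])
open import Data.Nat.DivMod using (_/_; m*n/n≡m)
open import Data.Nat.ListAction using (sum)
open import Data.Nat.ListAction.Properties using (sum-++)
open import Data.Nat.Properties
open import Data.Nat.Solver using (module +-*-Solver)
open import Data.Parity.Base using (Parity; 0ℙ; 1ℙ; _⁻¹)
open import Data.Parity.Properties using (⁻¹-involutive; suc-homo-⁻¹; +-homo-+) renaming (_≟_ to _≟ℙ_)
open import Data.Product using (Σ; _×_; _,_; proj₁; proj₂; ∃₂; ∃-syntax; map₁)
open import Data.Sum using (_⊎_; inj₁; inj₂)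
open import Data.Vec using (Vec; toList; fromList)
open import Data.Vec.Properties using (length-toList; toList∘fromList)
open import Function.Base using (_∘_)
open import Function.Bundles using (_⇔_; mk⇔; Equivalence)
open import Relation.Binary.PropositionalEquality
open import Relation.Nullary using (¬_; yes; no)
open import Relation.Unary using (Decidable)

open ≡-Reasoning
open +-*-Solver using (solve; _:*_; _:+_; con; _:=_)
open CommSemigroupProperties +-commutativeSemigroup using () renaming (interchange to +-interchange)
open CommSemigroupProperties *-commutativeSemigroup using () renaming (x∙yz≈y∙xz to *-left-comm)

length-cartesianProductWith : {X Y Z : Set} (f : X → Y → Z) (xs : List X) (ys : List Y) →
  length (cartesianProductWith f xs ys) ≡ length xs * length ys
length-cartesianProductWith f [] ys = refl
length-cartesianProductWith f (x ∷ xs) ys = begin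
  length (map (f x) ys ++ cartesianProductWith f xs ys)      ≡⟨ length-++ (map (f x) ys) ⟩
  length (map (f x) ys) + length (cartesianProductWith f xs ys)
    ≡⟨ cong₂ _+_ (length-map (f x) ys) (length-cartesianProductWith f xs ys) ⟩
  length ys + length xs * length ys                           ∎

sum-cartesianProductWith : {X Y Z : Set} (f : X → Y → Z) (v : Z → ℕ) (g : X → ℕ) (h : Y → ℕ) →
  (∀ x y → v (f x y) ≡ g x * h y) → ∀ xs ys →
  sum (map v (cartesianProductWith f xs ys)) ≡ sum (map g xs) * sum (map h ys)
sum-cartesianProductWith f v g h v-f [] ys = refl
sum-cartesianProductWith f v g h v-f (x ∷ xs) ys = begin
  sum (map v (map (f x) ys ++ cartesianProductWith f xs ys))
    ≡⟨ cong sum (map-++ v (map (f x) ys) _) ⟩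
  sum (map v (map (f x) ys) ++ map v (cartesianProductWith f xs ys))
    ≡⟨ sum-++ (map v (map (f x) ys)) _ ⟩
  sum (map v (map (f x) ys)) + sum (map v (cartesianProductWith f xs ys))
    ≡⟨ cong₂ _+_ (row ys) (sum-cartesianProductWith f v g h v-f xs ys) ⟩
  g x * sum (map h ys) + sum (map g xs) * sum (map h ys)
    ≡⟨ *-distribʳ-+ (sum (map h ys)) (g x) _ ⟨
  (g x + sum (map g xs)) * sum (map h ys) ∎
  where
  row : ∀ ys → sum (map v (map (f x) ys)) ≡ g x * sum (map h ys)
  row [] = sym (*-zeroʳ (g x))
  row (y ∷ ys) = trans (cong₂ _+_ (v-f x y) (row ys)) (sym (*-distribˡ-+ (g x) (h y) _))

prod-++ : ∀ xs ys → prod (xs ++ ys) ≡ prod xs * prod ys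
prod-++ [] ys = sym (+-identityʳ _)
prod-++ (x ∷ xs) ys = trans (cong (x *_) (prod-++ xs ys)) (sym (*-assoc x _ _))

sum-filter : {X : Set} {P : X → Set} (P? : Decidable P) (v : X → ℕ) → (∀ x → ¬ P x → v x ≡ 0) →
             ∀ xs → sum (map v (filter P? xs)) ≡ sum (map v xs)
sum-filter P? v v-¬P [] = refl
sum-filter P? v v-¬P (x ∷ xs) with P? x
... | yes _ = cong (v x +_) (sum-filter P? v v-¬P xs)
... | no ¬Px = trans (sum-filter P? v v-¬P xs) (cong (_+ sum (map v xs)) (sym (v-¬P x ¬Px)))

unique-length : {X : Set} {xs ys : List X} → Unique xs → Unique ys → (∀ {z} → z ∈ xs ⇔ z ∈ ys) →
                length xs ≡ length ys
unique-length xs! ys! same = ↭-length (∼bag⇒↭ (unique∧set⇒bag xs! ys! same))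

-- Sums over the decompositions w ≡ x ++ t ∷ y

complement : Letter → Letter
complement A = Ā
complement Ā = A

Word : Set
Word = List Letter

ifSame : Letter → Letter → ℕ → ℕ
ifSame A A n = n
ifSame Ā Ā n = n
ifSame A Ā _ = 0
ifSame Ā A _ = 0

-- splitSum t w f = Σ { f x y ∣ w ≡ x ++ t ∷ y }
splitSum : Letter → Word → (Word → Word → ℕ) → ℕ
splitSum t [] f = 0
splitSum t (d ∷ w) f = ifSame t d (f [] w) + splitSum t w (λ x y → f (d ∷ x) y)

splitSum-cong : ∀ t w f g → (∀ x y → w ≡ x ++ t ∷ y → f x y ≡ g x y) →
                splitSum t w f ≡ splitSum t w g
splitSum-cong t [] f g eq = refl
splitSum-cong t (d ∷ w) f g eq =
  cong₂ _+_ (head t d refl refl) (splitSum-cong t w _ _ λ x y e → eq (d ∷ x) y (cong (d ∷_) e))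
  where
  head : ∀ t′ d′ → t′ ≡ t → d′ ≡ d → ifSame t′ d′ (f [] w) ≡ ifSame t′ d′ (g [] w)
  head A A refl refl = eq [] w refl
  head Ā Ā refl refl = eq [] w refl
  head A Ā _ _ = refl
  head Ā A _ _ = refl

ifSame-zero : ∀ t d → ifSame t d 0 ≡ 0
ifSame-zero A A = refl
ifSame-zero Ā Ā = refl
ifSame-zero A Ā = refl
ifSame-zero Ā A = refl

ifSame-+ : ∀ t d a b → ifSame t d (a + b) ≡ ifSame t d a + ifSame t d b
ifSame-+ A A a b = refl
ifSame-+ Ā Ā a b = refl
ifSame-+ A Ā a b = refl
ifSame-+ Ā A a b = refl

ifSame-* : ∀ t d k a → ifSame t d (k * a) ≡ k * ifSame t d a
ifSame-* A A k a = refl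
ifSame-* Ā Ā k a = refl
ifSame-* A Ā k a = sym (*-zeroʳ k)
ifSame-* Ā A k a = sym (*-zeroʳ k)

ifSame-*-zero : ∀ t d {m n} → m ≡ 0 → ifSame t d (m * n) ≡ 0
ifSame-*-zero t d {n = n} refl = ifSame-zero t d

splitSum-zero : ∀ t w → splitSum t w (λ _ _ → 0) ≡ 0
splitSum-zero t [] = refl
splitSum-zero t (d ∷ w) = cong₂ _+_ (ifSame-zero t d) (splitSum-zero t w)

splitSum-+ : ∀ t w f g → splitSum t w (λ x y → f x y + g x y) ≡ splitSum t w f + splitSum t w g
splitSum-+ t [] f g = refl
splitSum-+ t (d ∷ w) f g = begin
  ifSame t d (f [] w + g [] w) + splitSum t w (λ x y → f (d ∷ x) y + g (d ∷ x) y)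
    ≡⟨ cong₂ _+_ (ifSame-+ t d _ _) (splitSum-+ t w _ _) ⟩
  (ifSame t d (f [] w) + ifSame t d (g [] w)) + (splitSum t w (λ x y → f (d ∷ x) y) + splitSum t w (λ x y → g (d ∷ x) y))
    ≡⟨ +-interchange (ifSame t d (f [] w)) _ _ _ ⟩
  _ ∎

*-splitSum : ∀ t w k f → k * splitSum t w f ≡ splitSum t w (λ x y → k * f x y)
*-splitSum t [] k f = *-zeroʳ k
*-splitSum t (d ∷ w) k f = begin
  k * (ifSame t d (f [] w) + splitSum t w (λ x y → f (d ∷ x) y))
    ≡⟨ *-distribˡ-+ k _ _ ⟩
  k * ifSame t d (f [] w) + k * splitSum t w (λ x y → f (d ∷ x) y)
    ≡⟨ cong₂ _+_ (sym (ifSame-* t d k _)) (*-splitSum t w k _) ⟩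
  _ ∎

splitSum-* : ∀ t w k f → splitSum t w f * k ≡ splitSum t w (λ x y → f x y * k)
splitSum-* t w k f = begin
  splitSum t w f * k                   ≡⟨ *-comm _ k ⟩
  k * splitSum t w f                   ≡⟨ *-splitSum t w k f ⟩
  splitSum t w (λ x y → k * f x y)     ≡⟨ splitSum-cong t w _ _ (λ x y _ → *-comm k (f x y)) ⟩
  splitSum t w (λ x y → f x y * k)     ∎

ifSame-splitSum : ∀ t d s w f → ifSame t d (splitSum s w f) ≡ splitSum s w (λ x y → ifSame t d (f x y))
ifSame-splitSum A A s w f = refl
ifSame-splitSum Ā Ā s w f = refl
ifSame-splitSum A Ā s w f = sym (splitSum-zero s w)
ifSame-splitSum Ā A s w f = sym (splitSum-zero s w)

splitSum-comm : ∀ t u s v (h : Word → Word → Word → Word → ℕ) →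
  splitSum t u (λ x y → splitSum s v (λ a b → h x y a b)) ≡ splitSum s v (λ a b → splitSum t u (λ x y → h x y a b))
splitSum-comm t [] s v h = sym (splitSum-zero s v)
splitSum-comm t (d ∷ u) s v h = begin
  ifSame t d (splitSum s v (λ a b → h [] u a b)) + splitSum t u (λ x y → splitSum s v (λ a b → h (d ∷ x) y a b))
    ≡⟨ cong₂ _+_ (ifSame-splitSum t d s v _) (splitSum-comm t u s v _) ⟩
  splitSum s v (λ a b → ifSame t d (h [] u a b)) + splitSum s v (λ a b → splitSum t u (λ x y → h (d ∷ x) y a b))
    ≡⟨ splitSum-+ s v _ _ ⟨
  _ ∎

splitSum-++ : ∀ t u v f →
  splitSum t (u ++ v) f ≡ splitSum t u (λ x y → f x (y ++ v)) + splitSum t v (λ x y → f (u ++ x) y)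
splitSum-++ t [] v f = refl
splitSum-++ t (d ∷ u) v f = begin
  ifSame t d (f [] (u ++ v)) + splitSum t (u ++ v) (λ x y → f (d ∷ x) y)
    ≡⟨ cong (ifSame t d (f [] (u ++ v)) +_) (splitSum-++ t u v _) ⟩
  ifSame t d (f [] (u ++ v)) + (splitSum t u (λ x y → f (d ∷ x) (y ++ v)) + splitSum t v (λ x y → f (d ∷ u ++ x) y))
    ≡⟨ +-assoc (ifSame t d (f [] (u ++ v))) _ _ ⟨
  _ ∎

-- Both sides sum h a b y over the decompositions r ≡ a ++ t ∷ b ++ s ∷ y.
splitSum-nested : ∀ s t r (h : Word → Word → Word → ℕ) →
  splitSum s r (λ x y → splitSum t x (λ a b → h a b y)) ≡ splitSum t r (λ a z → splitSum s z (λ b y → h a b y))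
splitSum-nested s t [] h = refl
splitSum-nested s t (d ∷ r) h = begin
  ifSame s d 0 + splitSum s r (λ x y → ifSame t d (h [] x y) + splitSum t x (λ a b → h (d ∷ a) b y))
    ≡⟨ cong₂ _+_ (ifSame-zero s d) (splitSum-+ s r _ _) ⟩
  splitSum s r (λ x y → ifSame t d (h [] x y)) + splitSum s r (λ x y → splitSum t x (λ a b → h (d ∷ a) b y))
    ≡⟨ cong₂ _+_ (sym (ifSame-splitSum t d s r _)) (splitSum-nested s t r _) ⟩
  _ ∎

module _ {X : Set} where

  keepIfSame : Letter → Letter → List X → List X
  keepIfSame A A l = l
  keepIfSame Ā Ā l = l
  keepIfSame A Ā _ = []
  keepIfSame Ā A _ = []

  splitConcat : Letter → Word → (Word → Word → List X) → List X
  splitConcat t [] f = []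
  splitConcat t (d ∷ w) f = keepIfSame t d (f [] w) ++ splitConcat t w (λ x y → f (d ∷ x) y)

  sum-splitConcat : ∀ (v : X → ℕ) t w f →
    sum (map v (splitConcat t w f)) ≡ splitSum t w (λ x y → sum (map v (f x y)))
  sum-splitConcat v t [] f = refl
  sum-splitConcat v t (d ∷ w) f = begin
    sum (map v (keepIfSame t d (f [] w) ++ splitConcat t w (λ x y → f (d ∷ x) y)))
      ≡⟨ cong sum (map-++ v (keepIfSame t d (f [] w)) _) ⟩
    sum (map v (keepIfSame t d (f [] w)) ++ map v (splitConcat t w (λ x y → f (d ∷ x) y)))
      ≡⟨ sum-++ (map v (keepIfSame t d (f [] w))) _ ⟩
    sum (map v (keepIfSame t d (f [] w))) + sum (map v (splitConcat t w (λ x y → f (d ∷ x) y)))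
      ≡⟨ cong₂ _+_ (head t d) (sum-splitConcat v t w _) ⟩
    _ ∎
    where
    head : ∀ t d → sum (map v (keepIfSame t d (f [] w))) ≡ ifSame t d (sum (map v (f [] w)))
    head A A = refl
    head Ā Ā = refl
    head A Ā = refl
    head Ā A = refl

  length-splitConcat : ∀ t w f → length (splitConcat t w f) ≡ splitSum t w (λ x y → length (f x y))
  length-splitConcat t [] f = refl
  length-splitConcat t (d ∷ w) f = begin
    length (keepIfSame t d (f [] w) ++ splitConcat t w (λ x y → f (d ∷ x) y))
      ≡⟨ length-++ (keepIfSame t d (f [] w)) ⟩
    length (keepIfSame t d (f [] w)) + length (splitConcat t w (λ x y → f (d ∷ x) y))
      ≡⟨ cong₂ _+_ (head t d) (length-splitConcat t w _) ⟩
    _ ∎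
    where
    head : ∀ t d → length (keepIfSame t d (f [] w)) ≡ ifSame t d (length (f [] w))
    head A A = refl
    head Ā Ā = refl
    head A Ā = refl
    head Ā A = refl

  All-splitConcat : ∀ (P : X → Set) t w f → (∀ x y → w ≡ x ++ t ∷ y → All P (f x y)) →
                    All P (splitConcat t w f)
  All-splitConcat P t [] f h = []
  All-splitConcat P t (d ∷ w) f h =
    All.++⁺ (head t d refl refl) (All-splitConcat P t w _ (λ x y e → h (d ∷ x) y (cong (d ∷_) e)))
    where
    head : ∀ t′ d′ → t′ ≡ t → d′ ≡ d → All P (keepIfSame t′ d′ (f [] w))
    head A A refl refl = h [] w refl
    head Ā Ā refl refl = h [] w refl
    head A Ā _ _ = []
    head Ā A _ _ = []

  ∈-keepIfSame⁻ : ∀ t d {l : List X} {z} → z ∈ keepIfSame t d l → d ≡ t × z ∈ l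
  ∈-keepIfSame⁻ A A z∈l = refl , z∈l
  ∈-keepIfSame⁻ Ā Ā z∈l = refl , z∈l

  ∈-splitConcat⁻ : ∀ t w (f : Word → Word → List X) {z} → z ∈ splitConcat t w f →
                   ∃₂ λ x y → w ≡ x ++ t ∷ y × z ∈ f x y
  ∈-splitConcat⁻ t (d ∷ w) f z∈ with ∈-++⁻ (keepIfSame t d (f [] w)) z∈
  ... | inj₁ z∈head = let d≡t , z∈f = ∈-keepIfSame⁻ t d z∈head in [] , w , cong (_∷ w) d≡t , z∈f
  ... | inj₂ z∈tail = let x , y , e , z∈f = ∈-splitConcat⁻ t w _ z∈tail in d ∷ x , y , cong (d ∷_) e , z∈f

  ∈-splitConcat⁺ : ∀ t w (f : Word → Word → List X) x y {z} → w ≡ x ++ t ∷ y → z ∈ f x y →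
                   z ∈ splitConcat t w f
  ∈-splitConcat⁺ A .(A ∷ y) f [] y refl z∈f = ∈-++⁺ˡ z∈f
  ∈-splitConcat⁺ Ā .(Ā ∷ y) f [] y refl z∈f = ∈-++⁺ˡ z∈f
  ∈-splitConcat⁺ t (d ∷ w) f (.d ∷ x) y refl z∈f =
    ∈-++⁺ʳ (keepIfSame t d (f [] w)) (∈-splitConcat⁺ t w _ x y refl z∈f)

  Unique-splitConcat : ∀ t w (f : Word → Word → List X) →
    (∀ x y → w ≡ x ++ t ∷ y → Unique (f x y)) →
    (∀ x₁ y₁ x₂ y₂ {z} → w ≡ x₁ ++ t ∷ y₁ → w ≡ x₂ ++ t ∷ y₂ → z ∈ f x₁ y₁ → z ∈ f x₂ y₂ →
                         length x₁ ≡ length x₂) →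
    Unique (splitConcat t w f)
  Unique-splitConcat t [] f unique disjoint = []
  Unique-splitConcat t (d ∷ w) f unique disjoint =
    Unique.++⁺ (head t d refl refl)
      (Unique-splitConcat t w _ (λ x y e → unique (d ∷ x) y (cong (d ∷_) e))
        (λ x₁ y₁ x₂ y₂ e₁ e₂ z₁ z₂ →
           suc-injective (disjoint (d ∷ x₁) y₁ (d ∷ x₂) y₂ (cong (d ∷_) e₁) (cong (d ∷_) e₂) z₁ z₂)))
      λ (z∈head , z∈tail) →
        let d≡t , z∈f = ∈-keepIfSame⁻ t d z∈head
            x , y , e , z∈f′ = ∈-splitConcat⁻ t w _ z∈tail
        in 0≢1+n (disjoint [] w (d ∷ x) y (cong (_∷ w) d≡t) (cong (d ∷_) e) z∈f z∈f′)
    where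
    head : ∀ t′ d′ → t′ ≡ t → d′ ≡ d → Unique (keepIfSame t′ d′ (f [] w))
    head A A refl refl = unique [] w refl
    head Ā Ā refl refl = unique [] w refl
    head A Ā _ _ = []
    head Ā A _ _ = []

-- Non-crossing matchings

splitLengths : ∀ {w x y : Word} {t n} → length w ≤ n → w ≡ x ++ t ∷ y → length x ≤ n × length y ≤ n
splitLengths {x = x} {y} w≤n refl =
  ≤-trans (length-++-≤ˡ x) w≤n , ≤-trans (≤-trans (n≤1+n _) (length-++-≤ʳ (_ ∷ y) {x})) w≤n

-- The number of non-crossing perfect matchings of w in which every letter c is matched with a later
-- letter partner c: the first letter is matched with the letter separating an inner part x from an
-- outer part y.  Any fuel ≥ length w gives the same value.
matchingsWithin : (Letter → Letter) → ℕ → Word → ℕ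
matchingsWithin partner _ [] = 1
matchingsWithin partner zero (_ ∷ _) = 0
matchingsWithin partner (suc fuel) (c ∷ w) =
  splitSum (partner c) w (λ x y → matchingsWithin partner fuel x * matchingsWithin partner fuel y)

matchings : (Letter → Letter) → Word → ℕ
matchings partner w = matchingsWithin partner (length w) w

matchingsWithin-fuel : ∀ partner m n w → length w ≤ m → length w ≤ n →
                       matchingsWithin partner m w ≡ matchingsWithin partner n w
matchingsWithin-fuel partner m n [] _ _ = refl
matchingsWithin-fuel partner (suc m) (suc n) (c ∷ w) (s≤s w≤m) (s≤s w≤n) =
  splitSum-cong (partner c) w _ _ λ x y e →
    let x≤m , y≤m = splitLengths w≤m e
        x≤n , y≤n = splitLengths w≤n e
    in cong₂ _*_ (matchingsWithin-fuel partner m n x x≤m x≤n) (matchingsWithin-fuel partner m n y y≤m y≤n)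

matchings-∷ : ∀ partner c w →
  matchings partner (c ∷ w) ≡ splitSum (partner c) w (λ x y → matchings partner x * matchings partner y)
matchings-∷ partner c w = splitSum-cong (partner c) w _ _ λ x y e →
  let x≤w , y≤w = splitLengths ≤-refl e
  in cong₂ _*_ (matchingsWithin-fuel partner _ _ x x≤w ≤-refl) (matchingsWithin-fuel partner _ _ y y≤w ≤-refl)

parity-suc : ∀ n → parity (suc n) ≡ parity n ⁻¹
parity-suc n = trans (sym (⁻¹-involutive (parity (suc n)))) (cong _⁻¹ (suc-homo-⁻¹ n))

parity-pred : ∀ n → parity (suc n) ≡ 1ℙ → parity n ≡ 0ℙ
parity-pred n odd = trans (sym (suc-homo-⁻¹ n)) (cong _⁻¹ odd)

odd-summand : ∀ m n → parity (m + suc n) ≡ 0ℙ → parity m ≡ 1ℙ ⊎ parity n ≡ 1ℙ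
odd-summand m n even with parity m | parity n | parity-suc n | trans (sym (+-homo-+ m (suc n))) even
... | 1ℙ | _  | _  | _ = inj₁ refl
... | 0ℙ | 1ℙ | _  | _ = inj₂ refl
... | 0ℙ | 0ℙ | p | q with () ← trans (sym q) p

matchingsWithin-odd : ∀ partner fuel w → parity (length w) ≡ 1ℙ → matchingsWithin partner fuel w ≡ 0
matchingsWithin-odd partner fuel [] ()
matchingsWithin-odd partner zero (c ∷ w) _ = refl
matchingsWithin-odd partner (suc fuel) (c ∷ w) odd =
  trans (splitSum-cong (partner c) w _ _ oddPart) (splitSum-zero (partner c) w)
  where
  M : Word → ℕ
  M = matchingsWithin partner fuel
  oddPart : ∀ x y → w ≡ x ++ partner c ∷ y → M x * M y ≡ 0
  oddPart x y refl with odd-summand (length x) (length y)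
                         (subst (λ l → parity l ≡ 0ℙ) (length-++ x {partner c ∷ y}) (parity-pred (length w) odd))
  ... | inj₁ x-odd = cong (_* M y) (matchingsWithin-odd partner fuel x x-odd)
  ... | inj₂ y-odd = trans (cong (M x *_) (matchingsWithin-odd partner fuel y y-odd)) (*-zeroʳ (M x))

-- Valid plane trees

isComp-complement : ∀ a → isComp a (complement a) ≡ true
isComp-complement A = refl
isComp-complement Ā = refl

isComp⇒complement : ∀ a b → isComp a b ≡ true → b ≡ complement a
isComp⇒complement A Ā _ = refl
isComp⇒complement Ā A _ = refl

vForest-∷ : ∀ t ts a w b w′ → vTree t w ≡ just (b ∷ w′) → isComp a b ≡ true →
            vForest (t ∷ ts) (a ∷ w) ≡ vForest ts w′
vForest-∷ t ts a w b w′ t-reads ab rewrite t-reads | ab = refl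

vForest-∷⁻ : ∀ t ts a w r → vForest (t ∷ ts) (a ∷ w) ≡ just r →
  ∃₂ λ b w′ → vTree t w ≡ just (b ∷ w′) × isComp a b ≡ true × vForest ts w′ ≡ just r
vForest-∷⁻ t ts a w r reads with vTree t w
... | just (b ∷ w′) with isComp a b in ab
...   | true = b , w′ , refl , ab , reads

vForest-++ : ∀ f x s r → vForest f x ≡ just s → vForest f (x ++ r) ≡ just (s ++ r)
vForest-++ [] x s r refl = refl
vForest-++ (node ch ∷ ts) (a ∷ x) s r reads =
  let b , w′ , ch-reads , ab , ts-reads = vForest-∷⁻ (node ch) ts a x s reads in
  trans (vForest-∷ (node ch) ts a (x ++ r) b (w′ ++ r) (vForest-++ ch x (b ∷ w′) r ch-reads) ab)
        (vForest-++ ts w′ s r ts-reads)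

vForest-prefix : ∀ f w s → vForest f w ≡ just s → Σ Word λ x → w ≡ x ++ s × vForest f x ≡ just []
vForest-prefix [] w s refl = [] , refl , refl
vForest-prefix (node ch ∷ ts) (a ∷ w) s reads =
  let b , w′ , ch-reads , ab , ts-reads = vForest-∷⁻ (node ch) ts a w s reads
      x₁ , w≡ , ch-reads′ = vForest-prefix ch w (b ∷ w′) ch-reads
      x₂ , w′≡ , ts-reads′ = vForest-prefix ts w′ s ts-reads
  in a ∷ x₁ ++ b ∷ x₂ ,
     cong (a ∷_) (trans w≡ (trans (cong (λ z → x₁ ++ b ∷ z) w′≡) (sym (++-assoc x₁ (b ∷ x₂) s)))) ,
     trans (vForest-∷ (node ch) ts a (x₁ ++ b ∷ x₂) b x₂ (vForest-++ ch x₁ [] (b ∷ x₂) ch-reads′) ab) ts-reads′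

vForest-length : ∀ f w s → vForest f w ≡ just s → length w ≡ edgesF f * 2 + length s
vForest-length [] w s refl = refl
vForest-length (node ch ∷ ts) (a ∷ w) s reads =
  let b , w′ , ch-reads , ab , ts-reads = vForest-∷⁻ (node ch) ts a w s reads in
  cong suc (begin
    length w                                        ≡⟨ vForest-length ch w (b ∷ w′) ch-reads ⟩
    edgesF ch * 2 + suc (length w′)                 ≡⟨ cong (λ l → edgesF ch * 2 + suc l) (vForest-length ts w′ s ts-reads) ⟩
    edgesF ch * 2 + suc (edgesF ts * 2 + length s)  ≡⟨ rearrange (edgesF ch) (edgesF ts) (length s) ⟩
    suc ((edgesF ch + edgesF ts) * 2 + length s)    ∎)
  where
  rearrange : ∀ p q r → p * 2 + suc (q * 2 + r) ≡ suc ((p + q) * 2 + r)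
  rearrange = solve 3 (λ p q r → p :* con 2 :+ (con 1 :+ (q :* con 2 :+ r)) := con 1 :+ ((p :+ q) :* con 2 :+ r)) refl

plant : List PlaneTree → List PlaneTree → List PlaneTree
plant ch ts = node ch ∷ ts

plant-injective : ∀ {ch ch′ ts ts′} → plant ch ts ≡ plant ch′ ts′ → ch ≡ ch′ × ts ≡ ts′
plant-injective refl = refl , refl

-- The valid forests of a word a ∷ w: the first subtree reads an inner part x, the edge above it reads
-- a and its complement, and the remaining forest reads the outer part y.
forestsWithin : ℕ → Word → List (List PlaneTree)
forestsWithin _ [] = [] ∷ []
forestsWithin zero (_ ∷ _) = []
forestsWithin (suc fuel) (a ∷ w) =
  splitConcat (complement a) w (λ x y → cartesianProductWith plant (forestsWithin fuel x) (forestsWithin fuel y))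

length-forestsWithin : ∀ fuel w → length (forestsWithin fuel w) ≡ matchingsWithin complement fuel w
length-forestsWithin fuel [] = refl
length-forestsWithin zero (a ∷ w) = refl
length-forestsWithin (suc fuel) (a ∷ w) =
  trans (length-splitConcat (complement a) w _) (splitSum-cong (complement a) w _ _ λ x y _ →
    trans (length-cartesianProductWith plant (forestsWithin fuel x) (forestsWithin fuel y))
          (cong₂ _*_ (length-forestsWithin fuel x) (length-forestsWithin fuel y)))

∈-forestsWithin⁻ : ∀ fuel w f → f ∈ forestsWithin fuel w → vForest f w ≡ just []
∈-forestsWithin⁻ fuel [] .[] (here refl) = refl
∈-forestsWithin⁻ (suc fuel) (a ∷ w) f f∈ =
  let x , y , w≡ , f∈′ = ∈-splitConcat⁻ (complement a) w _ f∈
      ch , ts , ch∈ , ts∈ , f≡ = ∈-cartesianProductWith⁻ plant (forestsWithin fuel x) (forestsWithin fuel y) f∈′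
      ch-reads = trans (cong (vForest ch) w≡) (vForest-++ ch x [] (complement a ∷ y) (∈-forestsWithin⁻ fuel x ch ch∈))
  in subst (λ g → vForest g (a ∷ w) ≡ just []) (sym f≡)
       (trans (vForest-∷ (node ch) ts a w (complement a) y ch-reads (isComp-complement a))
              (∈-forestsWithin⁻ fuel y ts ts∈))

∈-forestsWithin⁺ : ∀ fuel w f → length w ≤ fuel → vForest f w ≡ just [] → f ∈ forestsWithin fuel w
∈-forestsWithin⁺ fuel [] [] _ _ = here refl
∈-forestsWithin⁺ (suc fuel) (a ∷ w) (node ch ∷ ts) (s≤s w≤fuel) reads =
  let b , w′ , ch-reads , ab , ts-reads = vForest-∷⁻ (node ch) ts a w [] reads
      x , w≡ , ch-reads′ = vForest-prefix ch w (b ∷ w′) ch-reads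
      split = trans w≡ (cong (λ c → x ++ c ∷ w′) (isComp⇒complement a b ab))
      x≤fuel , w′≤fuel = splitLengths w≤fuel split
  in ∈-splitConcat⁺ (complement a) w _ x w′ split
       (∈-cartesianProductWith⁺ plant (∈-forestsWithin⁺ fuel x ch x≤fuel ch-reads′)
                                      (∈-forestsWithin⁺ fuel w′ ts w′≤fuel ts-reads))

firstTree-closes-uniquely : ∀ ch a {x₁ y₁ x₂ y₂} → x₁ ++ a ∷ y₁ ≡ x₂ ++ a ∷ y₂ →
  vForest ch x₁ ≡ just [] → vForest ch x₂ ≡ just [] → length x₁ ≡ length x₂
firstTree-closes-uniquely ch a {x₁} {y₁} {x₂} {y₂} split reads₁ reads₂ =
  +-cancelʳ-≡ (suc (length y₁)) (length x₁) (length x₂) (begin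
    length x₁ + suc (length y₁)  ≡⟨ length-++ x₁ ⟨
    length (x₁ ++ a ∷ y₁)        ≡⟨ cong length split ⟩
    length (x₂ ++ a ∷ y₂)        ≡⟨ length-++ x₂ ⟩
    length x₂ + suc (length y₂)  ≡⟨ cong (λ y → length x₂ + suc (length y)) (sym y₁≡y₂) ⟩
    length x₂ + suc (length y₁)  ∎)
  where
  y₁≡y₂ : y₁ ≡ y₂
  y₁≡y₂ = ∷-injectiveʳ (just-injective (begin
    just (a ∷ y₁)               ≡⟨ vForest-++ ch x₁ [] (a ∷ y₁) reads₁ ⟨
    vForest ch (x₁ ++ a ∷ y₁)   ≡⟨ cong (vForest ch) split ⟩
    vForest ch (x₂ ++ a ∷ y₂)   ≡⟨ vForest-++ ch x₂ [] (a ∷ y₂) reads₂ ⟩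
    just (a ∷ y₂)               ∎))

Unique-forestsWithin : ∀ fuel w → Unique (forestsWithin fuel w)
Unique-forestsWithin fuel [] = [] ∷ []
Unique-forestsWithin zero (a ∷ w) = []
Unique-forestsWithin (suc fuel) (a ∷ w) = Unique-splitConcat (complement a) w _
  (λ x y _ → Unique.cartesianProductWith⁺ plant plant-injective (Unique-forestsWithin fuel x) (Unique-forestsWithin fuel y))
  λ x₁ y₁ x₂ y₂ w≡₁ w≡₂ f∈₁ f∈₂ →
    let ch₁ , _ , ch∈₁ , _ , f≡₁ = ∈-cartesianProductWith⁻ plant (forestsWithin fuel x₁) (forestsWithin fuel y₁) f∈₁
        ch₂ , _ , ch∈₂ , _ , f≡₂ = ∈-cartesianProductWith⁻ plant (forestsWithin fuel x₂) (forestsWithin fuel y₂) f∈₂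
        ch₁≡ch₂ = proj₁ (plant-injective (trans (sym f≡₁) f≡₂))
    in firstTree-closes-uniquely ch₁ (complement a) (trans (sym w≡₁) w≡₂)
         (∈-forestsWithin⁻ fuel x₁ ch₁ ch∈₁)
         (subst (λ ch → vForest ch x₂ ≡ just []) (sym ch₁≡ch₂) (∈-forestsWithin⁻ fuel x₂ ch₂ ch∈₂))

validTrees-count : ∀ n (w : Vec Letter (2 * n)) k → HasExactlyValid n w k → k ≡ matchings complement (toList w)
validTrees-count n w k (L , length≡k , L! , ∈L⇔) = begin
  k                                 ≡⟨ length≡k ⟨
  length L                          ≡⟨ unique-length L! (Unique.map⁺ node-injective (Unique-forestsWithin _ u)) ∈L⇔∈trees ⟩
  length (map node (forests u))     ≡⟨ length-map node (forests u) ⟩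
  length (forests u)                ≡⟨ length-forestsWithin (length u) u ⟩
  matchings complement u            ∎
  where
  u = toList w
  forests = forestsWithin (length u)
  node-injective : ∀ {f g} → node f ≡ node g → f ≡ g
  node-injective refl = refl
  edges-valid : ∀ f → vForest f u ≡ just [] → edgesF f ≡ n
  edges-valid f reads = *-cancelʳ-≡ (edgesF f) n 2 (begin
    edgesF f * 2      ≡⟨ +-identityʳ _ ⟨
    edgesF f * 2 + 0  ≡⟨ vForest-length f u [] reads ⟨
    length u          ≡⟨ length-toList w ⟩
    2 * n             ≡⟨ *-comm 2 n ⟩
    n * 2             ∎)
  ∈L⇔∈trees : ∀ {T} → T ∈ L ⇔ T ∈ map node (forests u)
  ∈L⇔∈trees {node f} = mk⇔
    (λ T∈L → ∈-map⁺ node (∈-forestsWithin⁺ (length u) u f ≤-refl (proj₂ (Equivalence.to (∈L⇔ (node f)) T∈L))))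
    (λ T∈ → let g , g∈ , T≡ = ∈-map⁻ node T∈
                reads = ∈-forestsWithin⁻ (length u) u g g∈
            in subst (_∈ L) (sym T≡) (Equivalence.from (∈L⇔ (node g)) (edges-valid g reads , reads)))

-- Flipping every other letter

flipIf : Parity → Letter → Letter
flipIf 0ℙ a = a
flipIf 1ℙ a = complement a

alternate : Parity → Word → Word
alternate p [] = []
alternate p (a ∷ w) = flipIf p a ∷ alternate (p ⁻¹) w

phase : Parity → ℕ → Parity
phase p zero = p
phase p (suc n) = phase p n ⁻¹

phase-⁻¹ : ∀ p n → phase (p ⁻¹) n ≡ phase p n ⁻¹
phase-⁻¹ p zero = refl
phase-⁻¹ p (suc n) = cong _⁻¹ (phase-⁻¹ p n)

phase-even : ∀ p n → parity n ≡ 0ℙ → phase p n ≡ p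
phase-even p zero _ = refl
phase-even p (suc (suc n)) even = trans (⁻¹-involutive (phase p n)) (phase-even p n even)

length-alternate : ∀ p w → length (alternate p w) ≡ length w
length-alternate p [] = refl
length-alternate p (a ∷ w) = cong suc (length-alternate (p ⁻¹) w)

-- Splitting alternate p w at its (length x)-th letter splits w at the same place, the letter in
-- between being flipped according to the phase reached there.
splitSum-alternate : ∀ w p t t′ (f g : Word → Word → ℕ) →
  (∀ x d y → w ≡ x ++ d ∷ y →
     ifSame t d (f x y) ≡ ifSame t′ (flipIf (phase p (length x)) d) (g (alternate p x) (alternate (phase p (length x) ⁻¹) y))) →
  splitSum t w f ≡ splitSum t′ (alternate p w) g
splitSum-alternate [] p t t′ f g eq = refl
splitSum-alternate (d ∷ w) p t t′ f g eq =
  cong₂ _+_ (eq [] d w refl) (splitSum-alternate w (p ⁻¹) t t′ _ _ λ x d′ y e →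
    trans (eq (d ∷ x) d′ y (cong (d ∷_) e))
          (cong (λ q → ifSame t′ (flipIf q d′) (g (flipIf p d ∷ alternate (p ⁻¹) x) (alternate (q ⁻¹) y)))
                (sym (phase-⁻¹ p (length x)))))

ifSame-flipIf : ∀ a d p n → ifSame (complement a) d n ≡ ifSame (flipIf p a) (flipIf (p ⁻¹) d) n
ifSame-flipIf A A 0ℙ n = refl
ifSame-flipIf A A 1ℙ n = refl
ifSame-flipIf A Ā 0ℙ n = refl
ifSame-flipIf A Ā 1ℙ n = refl
ifSame-flipIf Ā A 0ℙ n = refl
ifSame-flipIf Ā A 1ℙ n = refl
ifSame-flipIf Ā Ā 0ℙ n = refl
ifSame-flipIf Ā Ā 1ℙ n = refl

sameMatchings : Word → ℕ
sameMatchings = matchings (λ c → c)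

matchings-alternate : ∀ w p → matchings complement w ≡ sameMatchings (alternate p w)
matchings-alternate w p = go (length w) w ≤-refl p
  where
  go : ∀ n w → length w ≤ n → ∀ p → matchings complement w ≡ sameMatchings (alternate p w)
  go n [] _ p = refl
  go (suc n) (a ∷ w) (s≤s w≤n) p = begin
    matchings complement (a ∷ w)
      ≡⟨ matchings-∷ complement a w ⟩
    splitSum (complement a) w (λ x y → matchings complement x * matchings complement y)
      ≡⟨ splitSum-alternate w (p ⁻¹) (complement a) (flipIf p a) _ _ pieces ⟩
    splitSum (flipIf p a) (alternate (p ⁻¹) w) (λ x y → sameMatchings x * sameMatchings y)
      ≡⟨ matchings-∷ (λ c → c) (flipIf p a) (alternate (p ⁻¹) w) ⟨
    sameMatchings (alternate p (a ∷ w)) ∎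
    where
    pieces : ∀ x d y → w ≡ x ++ d ∷ y →
      ifSame (complement a) d (matchings complement x * matchings complement y) ≡
      ifSame (flipIf p a) (flipIf (phase (p ⁻¹) (length x)) d)
             (sameMatchings (alternate (p ⁻¹) x) * sameMatchings (alternate (phase (p ⁻¹) (length x) ⁻¹) y))
    pieces x d y w≡ with parity (length x) in x-parity
    ... | 1ℙ = trans (ifSame-*-zero (complement a) d (matchingsWithin-odd complement _ x x-parity))
                     (sym (ifSame-*-zero (flipIf p a) _ (matchingsWithin-odd (λ c → c) _ (alternate (p ⁻¹) x) alternate-odd)))
      where
      alternate-odd = trans (cong parity (length-alternate (p ⁻¹) x)) x-parity
    ... | 0ℙ rewrite phase-even (p ⁻¹) (length x) x-parity =
      let x≤n , y≤n = splitLengths w≤n w≡ in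
      trans (ifSame-flipIf a d p _)
            (cong (ifSame (flipIf p a) (flipIf (p ⁻¹) d)) (cong₂ _*_ (go n x x≤n (p ⁻¹)) (go n y y≤n (p ⁻¹ ⁻¹))))

-- Regions cut out by the A-arcs

sameMatchings-∷ : ∀ c w → sameMatchings (c ∷ w) ≡ splitSum c w (λ x y → sameMatchings x * sameMatchings y)
sameMatchings-∷ = matchings-∷ (λ c → c)

-- The first A is matched with a later A, enclosing y; the Ā's before it join the part z after that A.
sameMatchings-firstA : ∀ x → All (_≡ Ā) x → ∀ r →
  sameMatchings (x ++ A ∷ r) ≡ splitSum A r (λ y z → sameMatchings y * sameMatchings (x ++ z))
sameMatchings-firstA x x-Ā r = go (length x) x ≤-refl x-Ā r
  where
  G = sameMatchings
  go : ∀ n x → length x ≤ n → All (_≡ Ā) x → ∀ r → G (x ++ A ∷ r) ≡ splitSum A r (λ y z → G y * G (x ++ z))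
  go n [] _ _ r = sameMatchings-∷ A r
  go (suc n) (Ā ∷ x) (s≤s x≤n) (refl ∷ x-Ā) r = begin
    G (Ā ∷ x ++ A ∷ r)
      ≡⟨ sameMatchings-∷ Ā (x ++ A ∷ r) ⟩
    splitSum Ā (x ++ A ∷ r) (λ a b → G a * G b)
      ≡⟨ splitSum-++ Ā x (A ∷ r) _ ⟩
    splitSum Ā x (λ a b → G a * G (b ++ A ∷ r)) + splitSum Ā r (λ a b → G (x ++ A ∷ a) * G b)
      ≡⟨ cong₂ _+_ partnerInside partnerAfter ⟩
    splitSum A r (λ y z → splitSum Ā x (λ a b → G y * (G a * G (b ++ z)))) +
    splitSum A r (λ y z → splitSum Ā z (λ a b → G y * (G (x ++ a) * G b)))
      ≡⟨ splitSum-+ A r _ _ ⟨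
    splitSum A r (λ y z → splitSum Ā x (λ a b → G y * (G a * G (b ++ z))) + splitSum Ā z (λ a b → G y * (G (x ++ a) * G b)))
      ≡⟨ splitSum-cong A r _ _ (λ y z _ → cong₂ _+_ (sym (*-splitSum Ā x (G y) _)) (sym (*-splitSum Ā z (G y) _))) ⟩
    splitSum A r (λ y z → G y * splitSum Ā x (λ a b → G a * G (b ++ z)) + G y * splitSum Ā z (λ a b → G (x ++ a) * G b))
      ≡⟨ splitSum-cong A r _ _ (λ y z _ → sym (*-distribˡ-+ (G y) _ _)) ⟩
    splitSum A r (λ y z → G y * (splitSum Ā x (λ a b → G a * G (b ++ z)) + splitSum Ā z (λ a b → G (x ++ a) * G b)))
      ≡⟨ splitSum-cong A r _ _ (λ y z _ → cong (G y *_) (sym (splitSum-++ Ā x z _))) ⟩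
    splitSum A r (λ y z → G y * splitSum Ā (x ++ z) (λ a b → G a * G b))
      ≡⟨ splitSum-cong A r _ _ (λ y z _ → cong (G y *_) (sym (sameMatchings-∷ Ā (x ++ z)))) ⟩
    splitSum A r (λ y z → G y * G (Ā ∷ x ++ z)) ∎
    where
    partnerInside : splitSum Ā x (λ a b → G a * G (b ++ A ∷ r)) ≡
                    splitSum A r (λ y z → splitSum Ā x (λ a b → G y * (G a * G (b ++ z))))
    partnerInside = begin
      splitSum Ā x (λ a b → G a * G (b ++ A ∷ r))
        ≡⟨ splitSum-cong Ā x _ _ (λ a b x≡ →
             cong (G a *_) (go n b (proj₂ (splitLengths x≤n x≡)) (All.tail (All.++⁻ʳ a (subst (All (_≡ Ā)) x≡ x-Ā))) r)) ⟩
      splitSum Ā x (λ a b → G a * splitSum A r (λ y z → G y * G (b ++ z)))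
        ≡⟨ splitSum-cong Ā x _ _ (λ a b _ → *-splitSum A r (G a) _) ⟩
      splitSum Ā x (λ a b → splitSum A r (λ y z → G a * (G y * G (b ++ z))))
        ≡⟨ splitSum-comm Ā x A r _ ⟩
      splitSum A r (λ y z → splitSum Ā x (λ a b → G a * (G y * G (b ++ z))))
        ≡⟨ splitSum-cong A r _ _ (λ y z _ → splitSum-cong Ā x _ _ (λ a b _ → *-left-comm (G a) (G y) _)) ⟩
      _ ∎
    partnerAfter : splitSum Ā r (λ a b → G (x ++ A ∷ a) * G b) ≡
                   splitSum A r (λ y z → splitSum Ā z (λ a b → G y * (G (x ++ a) * G b)))
    partnerAfter = begin
      splitSum Ā r (λ a b → G (x ++ A ∷ a) * G b)
        ≡⟨ splitSum-cong Ā r _ _ (λ a b _ → cong (_* G b) (go n x x≤n x-Ā a)) ⟩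
      splitSum Ā r (λ a b → splitSum A a (λ y z → G y * G (x ++ z)) * G b)
        ≡⟨ splitSum-cong Ā r _ _ (λ a b _ → splitSum-* A a (G b) _) ⟩
      splitSum Ā r (λ a b → splitSum A a (λ y z → G y * G (x ++ z) * G b))
        ≡⟨ splitSum-nested Ā A r (λ y z b → G y * G (x ++ z) * G b) ⟩
      splitSum A r (λ y z → splitSum Ā z (λ a b → G y * G (x ++ a) * G b))
        ≡⟨ splitSum-cong A r _ _ (λ y z _ → splitSum-cong Ā z _ _ (λ a b _ → *-assoc (G y) _ _)) ⟩
      _ ∎

Ās : ℕ → Word
Ās k = replicate k Ā

All-Ās : ∀ k → All (_≡ Ā) (Ās k)
All-Ās zero = []
All-Ās (suc k) = refl ∷ All-Ās k

Ās-snoc : ∀ k u → Ās k ++ Ā ∷ u ≡ Ās (suc k) ++ u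
Ās-snoc zero u = refl
Ās-snoc (suc k) u = cong (Ā ∷_) (Ās-snoc k u)

noncrossing : ℕ → ℕ
noncrossing k = sameMatchings (Ās k)

-- A non-crossing matching of the A's of a word cuts its Ā's into regions: the outer one and one
-- inside every A-arc.  A profile records (size of the outer region , sizes of the inner regions).
Profile : Set
Profile = ℕ × List ℕ

regions : Profile → List ℕ
regions (outer , inner) = outer ∷ inner

enclose : Profile → Profile → Profile
enclose (ox , ix) (oy , iy) = oy , ox ∷ ix ++ iy

profilesWithin : ℕ → Word → List Profile
profilesWithin _ [] = (0 , []) ∷ []
profilesWithin zero (_ ∷ _) = []
profilesWithin (suc fuel) (Ā ∷ u) = map (map₁ suc) (profilesWithin fuel u)
profilesWithin (suc fuel) (A ∷ u) =
  splitConcat A u (λ x y → cartesianProductWith enclose (profilesWithin fuel x) (profilesWithin fuel y))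

-- The weight of a profile after p further Ā's are put in its outer region.
weight : ℕ → Profile → ℕ
weight p (outer , inner) = noncrossing (p + outer) * prod (map noncrossing inner)

weight-enclose : ∀ p e e′ → weight p (enclose e e′) ≡ weight 0 e * weight p e′
weight-enclose p (ox , ix) (oy , iy) = begin
  noncrossing (p + oy) * (noncrossing ox * prod (map noncrossing (ix ++ iy)))
    ≡⟨ cong (λ l → noncrossing (p + oy) * (noncrossing ox * prod l)) (map-++ noncrossing ix iy) ⟩
  noncrossing (p + oy) * (noncrossing ox * prod (map noncrossing ix ++ map noncrossing iy))
    ≡⟨ cong (λ m → noncrossing (p + oy) * (noncrossing ox * m)) (prod-++ (map noncrossing ix) (map noncrossing iy)) ⟩
  noncrossing (p + oy) * (noncrossing ox * (prod (map noncrossing ix) * prod (map noncrossing iy)))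
    ≡⟨ rearrange (noncrossing (p + oy)) (noncrossing ox) (prod (map noncrossing ix)) (prod (map noncrossing iy)) ⟩
  (noncrossing ox * prod (map noncrossing ix)) * (noncrossing (p + oy) * prod (map noncrossing iy)) ∎
  where
  rearrange : ∀ a b c d → a * (b * (c * d)) ≡ (b * c) * (a * d)
  rearrange = solve 4 (λ a b c d → a :* (b :* (c :* d)) := (b :* c) :* (a :* d)) refl

sameMatchings-profiles : ∀ u p → sameMatchings (Ās p ++ u) ≡ sum (map (weight p) (profilesWithin (length u) u))
sameMatchings-profiles u = go (length u) u ≤-refl
  where
  go : ∀ fuel u → length u ≤ fuel → ∀ p → sameMatchings (Ās p ++ u) ≡ sum (map (weight p) (profilesWithin fuel u))
  go fuel [] _ p = begin
    sameMatchings (Ās p ++ [])    ≡⟨ cong sameMatchings (++-identityʳ (Ās p)) ⟩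
    noncrossing p                 ≡⟨ cong noncrossing (+-identityʳ p) ⟨
    noncrossing (p + 0)           ≡⟨ *-identityʳ _ ⟨
    noncrossing (p + 0) * 1       ≡⟨ +-identityʳ _ ⟨
    weight p (0 , []) + 0         ∎
  go (suc fuel) (Ā ∷ u) (s≤s u≤fuel) p = begin
    sameMatchings (Ās p ++ Ā ∷ u)      ≡⟨ cong sameMatchings (Ās-snoc p u) ⟩
    sameMatchings (Ās (suc p) ++ u)    ≡⟨ go fuel u u≤fuel (suc p) ⟩
    sum (map (weight (suc p)) (profilesWithin fuel u))
      ≡⟨ cong sum (map-cong (λ (o , is) → cong (λ m → noncrossing m * prod (map noncrossing is)) (sym (+-suc p o)))
                            (profilesWithin fuel u)) ⟩
    sum (map (weight p ∘ map₁ suc) (profilesWithin fuel u))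
      ≡⟨ cong sum (map-∘ (profilesWithin fuel u)) ⟩
    sum (map (weight p) (map (map₁ suc) (profilesWithin fuel u))) ∎
  go (suc fuel) (A ∷ u) (s≤s u≤fuel) p = begin
    sameMatchings (Ās p ++ A ∷ u)
      ≡⟨ sameMatchings-firstA (Ās p) (All-Ās p) u ⟩
    splitSum A u (λ y z → sameMatchings y * sameMatchings (Ās p ++ z))
      ≡⟨ splitSum-cong A u _ _ (λ y z u≡ → let y≤ , z≤ = splitLengths u≤fuel u≡ in
           cong₂ _*_ (go fuel y y≤ 0) (go fuel z z≤ p)) ⟩
    splitSum A u (λ y z → sum (map (weight 0) (profilesWithin fuel y)) * sum (map (weight p) (profilesWithin fuel z)))
      ≡⟨ splitSum-cong A u _ _ (λ y z _ → sym (sum-cartesianProductWith enclose (weight p) (weight 0) (weight p)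
                                                  (weight-enclose p) (profilesWithin fuel y) (profilesWithin fuel z))) ⟩
    splitSum A u (λ y z → sum (map (weight p) (cartesianProductWith enclose (profilesWithin fuel y) (profilesWithin fuel z))))
      ≡⟨ sum-splitConcat (weight p) A u _ ⟨
    sum (map (weight p) (profilesWithin (suc fuel) (A ∷ u))) ∎

numA : Word → ℕ
numA [] = 0
numA (A ∷ u) = suc (numA u)
numA (Ā ∷ u) = numA u

numĀ : Word → ℕ
numĀ [] = 0
numĀ (A ∷ u) = numĀ u
numĀ (Ā ∷ u) = suc (numĀ u)

numA-split : ∀ y z → numA (y ++ A ∷ z) ≡ numA y + suc (numA z)
numA-split [] z = refl
numA-split (A ∷ y) z = cong suc (numA-split y z)
numA-split (Ā ∷ y) z = numA-split y z

numĀ-split : ∀ y z → numĀ (y ++ A ∷ z) ≡ numĀ y + numĀ z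
numĀ-split [] z = refl
numĀ-split (A ∷ y) z = numĀ-split y z
numĀ-split (Ā ∷ y) z = cong suc (numĀ-split y z)

numA+numĀ : ∀ u → numA u + numĀ u ≡ length u
numA+numĀ [] = refl
numA+numĀ (A ∷ u) = cong suc (numA+numĀ u)
numA+numĀ (Ā ∷ u) = trans (+-suc (numA u) (numĀ u)) (cong suc (numA+numĀ u))

numA-alternate-⁻¹ : ∀ p w → numA (alternate (p ⁻¹) w) ≡ numĀ (alternate p w)
numA-alternate-⁻¹ p [] = refl
numA-alternate-⁻¹ 0ℙ (A ∷ w) = numA-alternate-⁻¹ 1ℙ w
numA-alternate-⁻¹ 0ℙ (Ā ∷ w) = cong suc (numA-alternate-⁻¹ 1ℙ w)
numA-alternate-⁻¹ 1ℙ (A ∷ w) = cong suc (numA-alternate-⁻¹ 0ℙ w)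
numA-alternate-⁻¹ 1ℙ (Ā ∷ w) = numA-alternate-⁻¹ 0ℙ w

-- splitSumℕ f m = Σ { f i j ∣ i + 1 + j ≡ m }
splitSumℕ : (ℕ → ℕ → ℕ) → ℕ → ℕ
splitSumℕ f zero = 0
splitSumℕ f (suc m) = f 0 m + splitSumℕ (λ i j → f (suc i) j) m

splitSum-Ās : ∀ m (F : Word → Word → ℕ) → splitSum Ā (Ās m) F ≡ splitSumℕ (λ i j → F (Ās i) (Ās j)) m
splitSum-Ās zero F = refl
splitSum-Ās (suc m) F = cong (F [] (Ās m) +_) (splitSum-Ās m (λ x y → F (Ā ∷ x) y))

splitSum-numA : ∀ u (f : ℕ → ℕ → ℕ) → splitSum A u (λ y z → f (numA y) (numA z)) ≡ splitSumℕ f (numA u)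
splitSum-numA [] f = refl
splitSum-numA (Ā ∷ u) f = splitSum-numA u f
splitSum-numA (A ∷ u) f = cong (f 0 (numA u) +_) (splitSum-numA u (λ a b → f (suc a) b))

noncrossing-suc : ∀ m → noncrossing (suc m) ≡ splitSumℕ (λ i j → noncrossing i * noncrossing j) m
noncrossing-suc m = trans (sameMatchings-∷ Ā (Ās m)) (splitSum-Ās m (λ x y → sameMatchings x * sameMatchings y))

length-profilesWithin : ∀ fuel u → length u ≤ fuel → length (profilesWithin fuel u) ≡ noncrossing (numA u)
length-profilesWithin fuel [] _ = refl
length-profilesWithin (suc fuel) (Ā ∷ u) (s≤s u≤fuel) =
  trans (length-map (map₁ suc) (profilesWithin fuel u)) (length-profilesWithin fuel u u≤fuel)
length-profilesWithin (suc fuel) (A ∷ u) (s≤s u≤fuel) = begin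
  length (splitConcat A u (λ x y → cartesianProductWith enclose (profilesWithin fuel x) (profilesWithin fuel y)))
    ≡⟨ length-splitConcat A u _ ⟩
  splitSum A u (λ x y → length (cartesianProductWith enclose (profilesWithin fuel x) (profilesWithin fuel y)))
    ≡⟨ splitSum-cong A u _ _ (λ y z u≡ → let y≤ , z≤ = splitLengths u≤fuel u≡ in
         trans (length-cartesianProductWith enclose (profilesWithin fuel y) (profilesWithin fuel z))
               (cong₂ _*_ (length-profilesWithin fuel y y≤) (length-profilesWithin fuel z z≤))) ⟩
  splitSum A u (λ y z → noncrossing (numA y) * noncrossing (numA z))
    ≡⟨ splitSum-numA u (λ a b → noncrossing a * noncrossing b) ⟩
  splitSumℕ (λ i j → noncrossing i * noncrossing j) (numA u)
    ≡⟨ noncrossing-suc (numA u) ⟨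
  noncrossing (suc (numA u)) ∎

Shape : ℕ → ℕ → Profile → Set
Shape a b (outer , inner) = length inner + length inner ≡ a × sum (outer ∷ inner) ≡ b

Shape-enclose : ∀ {a b a′ b′} e e′ → Shape a b e → Shape a′ b′ e′ → Shape (suc (a + suc a′)) (b + b′) (enclose e e′)
Shape-enclose {a} {b} {a′} {b′} (ox , ix) (oy , iy) (ix≡ , ox+ix≡) (iy≡ , oy+iy≡) = inner≡ , total≡
  where
  inner≡ = begin
    suc (length (ix ++ iy)) + suc (length (ix ++ iy))
      ≡⟨ cong (λ k → suc k + suc k) (length-++ ix) ⟩
    suc (length ix + length iy) + suc (length ix + length iy)
      ≡⟨ rearrange (length ix) (length iy) ⟩
    suc ((length ix + length ix) + suc (length iy + length iy))
      ≡⟨ cong₂ (λ k l → suc (k + suc l)) ix≡ iy≡ ⟩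
    suc (a + suc a′) ∎
    where
    rearrange : ∀ m n → suc (m + n) + suc (m + n) ≡ suc ((m + m) + suc (n + n))
    rearrange = solve 2 (λ m n → (con 1 :+ (m :+ n)) :+ (con 1 :+ (m :+ n)) := con 1 :+ ((m :+ m) :+ (con 1 :+ (n :+ n)))) refl
  total≡ = begin
    oy + (ox + sum (ix ++ iy))        ≡⟨ cong (λ k → oy + (ox + k)) (sum-++ ix iy) ⟩
    oy + (ox + (sum ix + sum iy))     ≡⟨ rearrange oy ox (sum ix) (sum iy) ⟩
    (ox + sum ix) + (oy + sum iy)     ≡⟨ cong₂ _+_ ox+ix≡ oy+iy≡ ⟩
    b + b′                            ∎
    where
    rearrange : ∀ p q r s → p + (q + (r + s)) ≡ (q + r) + (p + s)
    rearrange = solve 4 (λ p q r s → p :+ (q :+ (r :+ s)) := (q :+ r) :+ (p :+ s)) refl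

profilesWithin-Shape : ∀ fuel u → length u ≤ fuel → All (Shape (numA u) (numĀ u)) (profilesWithin fuel u)
profilesWithin-Shape fuel [] _ = (refl , refl) ∷ []
profilesWithin-Shape (suc fuel) (Ā ∷ u) (s≤s u≤fuel) =
  All.map⁺ (All.map (λ (inner≡ , total≡) → inner≡ , cong suc total≡) (profilesWithin-Shape fuel u u≤fuel))
profilesWithin-Shape (suc fuel) (A ∷ u) (s≤s u≤fuel) = All-splitConcat _ A u _ λ y z u≡ →
  let y≤ , z≤ = splitLengths u≤fuel u≡ in
  subst₂ (λ a b → All (Shape a b) (cartesianProductWith enclose (profilesWithin fuel y) (profilesWithin fuel z)))
    (cong suc (sym (trans (cong numA u≡) (numA-split y z))))
    (sym (trans (cong numĀ u≡) (numĀ-split y z)))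
    (All.cartesianProductWith⁺ (setoid Profile) (setoid Profile) enclose _ _ λ {e} {e′} e∈ e′∈ →
       Shape-enclose e e′ (All.lookup (profilesWithin-Shape fuel y y≤) e∈) (All.lookup (profilesWithin-Shape fuel z z≤) e′∈))

-- Ballot numbers and Catalan numbers

splitSumℕ-cong : ∀ m f g → (∀ i j → suc (i + j) ≡ m → f i j ≡ g i j) → splitSumℕ f m ≡ splitSumℕ g m
splitSumℕ-cong zero f g eq = refl
splitSumℕ-cong (suc m) f g eq = cong₂ _+_ (eq 0 m refl) (splitSumℕ-cong m _ _ (λ i j e → eq (suc i) j (cong suc e)))

splitSumℕ-+ : ∀ m f g → splitSumℕ (λ i j → f i j + g i j) m ≡ splitSumℕ f m + splitSumℕ g m
splitSumℕ-+ zero f g = refl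
splitSumℕ-+ (suc m) f g =
  trans (cong ((f 0 m + g 0 m) +_) (splitSumℕ-+ m _ _)) (+-interchange (f 0 m) (g 0 m) _ _)

*-splitSumℕ : ∀ m k f → k * splitSumℕ f m ≡ splitSumℕ (λ i j → k * f i j) m
*-splitSumℕ zero k f = *-zeroʳ k
*-splitSumℕ (suc m) k f = trans (*-distribˡ-+ k _ _) (cong (k * f 0 m +_) (*-splitSumℕ m k _))

splitSumℕ-* : ∀ m k f → splitSumℕ f m * k ≡ splitSumℕ (λ i j → f i j * k) m
splitSumℕ-* m k f =
  trans (*-comm _ k) (trans (*-splitSumℕ m k f) (splitSumℕ-cong m _ _ (λ i j _ → *-comm k (f i j))))

splitSumℕ-nested : ∀ m (h : ℕ → ℕ → ℕ → ℕ) →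
  splitSumℕ (λ i j → splitSumℕ (λ a b → h a b j) i) m ≡ splitSumℕ (λ a z → splitSumℕ (λ b y → h a b y) z) m
splitSumℕ-nested zero h = refl
splitSumℕ-nested (suc m) h = begin
  0 + splitSumℕ (λ i j → h 0 i j + splitSumℕ (λ a b → h (suc a) b j) i) m
    ≡⟨ splitSumℕ-+ m _ _ ⟩
  splitSumℕ (λ i j → h 0 i j) m + splitSumℕ (λ i j → splitSumℕ (λ a b → h (suc a) b j) i) m
    ≡⟨ cong (splitSumℕ (λ i j → h 0 i j) m +_) (splitSumℕ-nested m (λ a → h (suc a))) ⟩
  _ ∎

summands≤ : ∀ {i j m} → suc (i + j) ≡ m → i ≤ m × j ≤ m
summands≤ {i} {j} refl = ≤-trans (m≤m+n i j) (n≤1+n _) , ≤-trans (m≤n+m j i) (n≤1+n _)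

-- ballot h m: the number of ±1 paths with m steps from height h down to height 0 that never go below 0.
ballot : ℕ → ℕ → ℕ
ballot zero zero = 1
ballot (suc h) zero = 0
ballot zero (suc m) = ballot 1 m
ballot (suc h) (suc m) = ballot (suc (suc h)) m + ballot h m

-- Decompose a path from height h + 1 at its first visit to height h.
ballot-suc : ∀ m h → ballot (suc h) m ≡ splitSumℕ (λ i j → ballot 0 i * ballot h j) m
ballot-suc m = go m m ≤-refl
  where
  go : ∀ n m → m ≤ n → ∀ h → ballot (suc h) m ≡ splitSumℕ (λ i j → ballot 0 i * ballot h j) m
  go n zero _ h = refl
  go (suc n) (suc m) (s≤s m≤n) h = begin
    ballot (suc (suc h)) m + ballot h m
      ≡⟨ cong (_+ ballot h m) (go n m m≤n (suc h)) ⟩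
    splitSumℕ (λ i j → ballot 0 i * ballot (suc h) j) m + ballot h m
      ≡⟨ cong (_+ ballot h m) (splitSumℕ-cong m _ _ (λ i j e → cong (ballot 0 i *_) (go n j (≤-trans (proj₂ (summands≤ e)) m≤n) h))) ⟩
    splitSumℕ (λ i j → ballot 0 i * splitSumℕ (λ a b → ballot 0 a * ballot h b) j) m + ballot h m
      ≡⟨ cong (_+ ballot h m) (splitSumℕ-cong m _ _ (λ i j _ → *-splitSumℕ j (ballot 0 i) _)) ⟩
    splitSumℕ (λ i j → splitSumℕ (λ a b → ballot 0 i * (ballot 0 a * ballot h b)) j) m + ballot h m
      ≡⟨ cong (_+ ballot h m) (splitSumℕ-nested m (λ i a b → ballot 0 i * (ballot 0 a * ballot h b))) ⟨
    splitSumℕ (λ i j → splitSumℕ (λ a b → ballot 0 a * (ballot 0 b * ballot h j)) i) m + ballot h m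
      ≡⟨ +-comm _ (ballot h m) ⟩
    ballot h m + splitSumℕ (λ i j → splitSumℕ (λ a b → ballot 0 a * (ballot 0 b * ballot h j)) i) m
      ≡⟨ cong₂ _+_ (sym (+-identityʳ (ballot h m))) (splitSumℕ-cong m _ _ (λ i j e →
           trans (splitSumℕ-cong i _ _ (λ a b _ → sym (*-assoc (ballot 0 a) (ballot 0 b) (ballot h j))))
           (trans (sym (splitSumℕ-* i (ballot h j) _)) (cong (_* ballot h j) (sym (go n i (≤-trans (proj₁ (summands≤ e)) m≤n) 0)))))) ⟩
    ballot h m + 0 + splitSumℕ (λ i j → ballot 1 i * ballot h j) m ∎

noncrossing≡ballot : ∀ m → noncrossing m ≡ ballot 0 m
noncrossing≡ballot m = go m m ≤-refl
  where
  go : ∀ n m → m ≤ n → noncrossing m ≡ ballot 0 m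
  go n zero _ = refl
  go (suc n) (suc m) (s≤s m≤n) = begin
    noncrossing (suc m)                                    ≡⟨ noncrossing-suc m ⟩
    splitSumℕ (λ i j → noncrossing i * noncrossing j) m    ≡⟨ splitSumℕ-cong m _ _ factors ⟩
    splitSumℕ (λ i j → ballot 0 i * ballot 0 j) m          ≡⟨ ballot-suc m 0 ⟨
    ballot 0 (suc m)                                       ∎
    where
    factors : ∀ i j → suc (i + j) ≡ m → noncrossing i * noncrossing j ≡ ballot 0 i * ballot 0 j
    factors i j i+1+j≡m = let i≤m , j≤m = summands≤ i+1+j≡m in
      cong₂ _*_ (go n i (≤-trans i≤m m≤n)) (go n j (≤-trans j≤m m≤n))

ballot-< : ∀ m h → m < h → ballot h m ≡ 0
ballot-< zero (suc h) _ = refl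
ballot-< (suc m) (suc h) (s≤s m<h) = cong₂ _+_ (ballot-< m (suc (suc h)) (m<n⇒m<1+n (m<n⇒m<1+n m<h))) (ballot-< m h m<h)

ballot-diagonal : ∀ h → ballot h h ≡ 1
ballot-diagonal zero = refl
ballot-diagonal (suc h) = cong₂ _+_ (ballot-< h (suc (suc h)) (m<n⇒m<1+n (n<1+n h))) (ballot-diagonal h)

-- n C (v - 1), with the convention n C (-1) = 0.
choosePred : ℕ → ℕ → ℕ
choosePred n zero = 0
choosePred n (suc v) = n C v

pascal : ∀ n v → suc n C suc v ≡ n C v + n C suc v
pascal n v = sym (nCk+nC[k+1]≡[n+1]C[k+1] n v)

pascal′ : ∀ n v → suc n C v ≡ choosePred n v + n C v
pascal′ n zero = refl
pascal′ n (suc v) = pascal n v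

-- The ballot formula: the h + 2u steps of such a path include u up-steps, and reflection subtracts the
-- C(h + 2u, u - 1) paths that go below 0.
ballot-formula : ∀ h u → ballot h (h + (u + u)) + choosePred (h + (u + u)) u ≡ (h + (u + u)) C u
ballot-formula h zero = begin
  ballot h (h + 0) + 0   ≡⟨ +-identityʳ _ ⟩
  ballot h (h + 0)       ≡⟨ cong (ballot h) (+-identityʳ h) ⟩
  ballot h h             ≡⟨ ballot-diagonal h ⟩
  1                      ∎
ballot-formula zero (suc v) = begin
  ballot zero (suc v + suc v) + (suc v + suc v) C v
    ≡⟨ cong (λ z → ballot zero z + z C v) (cong suc (+-suc v v)) ⟩
  ballot 1 n + suc n C v
    ≡⟨ cong (ballot 1 n +_) (pascal′ n v) ⟩
  ballot 1 n + (choosePred n v + n C v)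
    ≡⟨ +-assoc (ballot 1 n) _ _ ⟨
  (ballot 1 n + choosePred n v) + n C v
    ≡⟨ cong (_+ n C v) (ballot-formula 1 v) ⟩
  n C v + n C v
    ≡⟨ cong (n C v +_) symmetric ⟩
  n C v + n C suc v
    ≡⟨ pascal n v ⟨
  suc n C suc v
    ≡⟨ cong (λ z → suc z C suc v) (+-suc v v) ⟨
  (suc v + suc v) C suc v ∎
  where
  n = suc (v + v)
  symmetric : n C v ≡ n C suc v
  symmetric = sym (trans (nCk≡nC[n∸k] (s≤s (m≤m+n v v))) (cong (n C_) (m+n∸m≡n v v)))
ballot-formula (suc h) (suc v) = begin
  ballot (suc h) N + N C v
    ≡⟨ cong (λ z → ballot (suc h) z + z C v) N≡ ⟩
  (ballot (suc (suc h)) M + ballot h M) + suc M C v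
    ≡⟨ cong ((ballot (suc (suc h)) M + ballot h M) +_) (pascal′ M v) ⟩
  (ballot (suc (suc h)) M + ballot h M) + (choosePred M v + M C v)
    ≡⟨ +-interchange (ballot (suc (suc h)) M) (ballot h M) (choosePred M v) (M C v) ⟩
  (ballot (suc (suc h)) M + choosePred M v) + (ballot h M + M C v)
    ≡⟨ cong₂ _+_ (ballot-formula (suc (suc h)) v)
                 (trans (cong (λ z → ballot h z + z C v) (sym M≡)) (trans (ballot-formula h (suc v)) (cong (_C suc v) M≡))) ⟩
  M C v + M C suc v
    ≡⟨ pascal M v ⟨
  suc M C suc v
    ≡⟨ cong (_C suc v) N≡ ⟨
  N C suc v ∎
  where
  N = suc h + (suc v + suc v)
  M = suc (suc h) + (v + v)
  M≡ : h + (suc v + suc v) ≡ M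
  M≡ = trans (cong (h +_) (cong suc (+-suc v v))) (trans (+-suc h (suc (v + v))) (cong suc (+-suc h (v + v))))
  N≡ : N ≡ suc M
  N≡ = cong suc M≡

absorption : ∀ n k → suc k * (suc n C suc k) ≡ suc n * (n C k)
absorption zero zero = refl
absorption zero (suc k) = begin
  suc (suc k) * (1 C suc (suc k))  ≡⟨ cong (suc (suc k) *_) (k>n⇒nCk≡0 {1} {suc (suc k)} (s≤s (s≤s z≤n))) ⟩
  suc (suc k) * 0                  ≡⟨ *-zeroʳ (suc (suc k)) ⟩
  0                                ≡⟨ cong (1 *_) (k>n⇒nCk≡0 {0} {suc k} (s≤s z≤n)) ⟨
  1 * (0 C suc k)                  ∎
absorption (suc n′) k = begin
  suc k * (suc n C suc k)                      ≡⟨ cong (suc k *_) (pascal n k) ⟩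
  suc k * (n C k + n C suc k)                  ≡⟨ *-distribˡ-+ (suc k) (n C k) (n C suc k) ⟩
  suc k * (n C k) + suc k * (n C suc k)        ≡⟨ cong (suc k * (n C k) +_) (absorption n′ k) ⟩
  (n C k + k * (n C k)) + n * (n′ C k)         ≡⟨ cong (λ z → (n C k + z) + n * (n′ C k)) (lower k) ⟩
  (n C k + n * choosePred n′ k) + n * (n′ C k) ≡⟨ +-assoc (n C k) (n * choosePred n′ k) (n * (n′ C k)) ⟩
  n C k + (n * choosePred n′ k + n * (n′ C k)) ≡⟨ cong (n C k +_) (*-distribˡ-+ n (choosePred n′ k) (n′ C k)) ⟨
  n C k + n * (choosePred n′ k + n′ C k)       ≡⟨ cong (λ z → n C k + n * z) (pascal′ n′ k) ⟨
  n C k + n * (n C k)                          ∎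
  where
  n = suc n′
  lower : ∀ k → k * (n C k) ≡ n * choosePred n′ k
  lower zero = sym (*-zeroʳ n)
  lower (suc k′) = absorption n′ k′

choosePred-central : ∀ t → choosePred (t + t) t * suc t ≡ ((t + t) C t) * t
choosePred-central zero = refl
choosePred-central (suc t) = begin
  ((suc t + suc t) C t) * suc (suc t)    ≡⟨ cong (λ z → (z C t) * suc (suc t)) 2t+2≡ ⟩
  (suc n C t) * suc (suc t)              ≡⟨ cong (_* suc (suc t)) symmetric₂ ⟩
  (suc n C suc (suc t)) * suc (suc t)    ≡⟨ *-comm (suc n C suc (suc t)) (suc (suc t)) ⟩
  suc (suc t) * (suc n C suc (suc t))    ≡⟨ absorption n (suc t) ⟩
  suc n * (n C suc t)                    ≡⟨ cong (suc n *_) symmetric₁ ⟩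
  suc n * (n C t)                        ≡⟨ absorption n t ⟨
  suc t * (suc n C suc t)                ≡⟨ *-comm (suc t) (suc n C suc t) ⟩
  (suc n C suc t) * suc t                ≡⟨ cong (λ z → (z C suc t) * suc t) 2t+2≡ ⟨
  ((suc t + suc t) C suc t) * suc t      ∎
  where
  n = suc (t + t)
  2t+2≡ : suc t + suc t ≡ suc n
  2t+2≡ = cong suc (+-suc t t)
  symmetric₁ : n C suc t ≡ n C t
  symmetric₁ = trans (nCk≡nC[n∸k] (s≤s (m≤m+n t t))) (cong (n C_) (m+n∸m≡n t t))
  symmetric₂ : suc n C t ≡ suc n C suc (suc t)
  symmetric₂ = trans (nCk≡nC[n∸k] (≤-trans (m≤m+n t t) (≤-trans (n≤1+n _) (n≤1+n _))))
                     (cong (suc n C_) (trans (+-∸-assoc 2 {t + t} {t} (m≤m+n t t)) (cong (2 +_) (m+n∸m≡n t t))))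

catalan≡ballot : ∀ t → catalan t ≡ ballot 0 (t + t)
catalan≡ballot t = begin
  ((2 * t) C t) / suc t              ≡⟨ cong (λ z → (z C t) / suc t) (cong (t +_) (+-identityʳ t)) ⟩
  ((t + t) C t) / suc t              ≡⟨ cong (_/ suc t) central≡ ⟩
  (ballot 0 (t + t) * suc t) / suc t ≡⟨ m*n/n≡m (ballot 0 (t + t)) (suc t) ⟩
  ballot 0 (t + t)                   ∎
  where
  central = (t + t) C t
  below = choosePred (t + t) t * suc t
  central≡ : central ≡ ballot 0 (t + t) * suc t
  central≡ = +-cancelʳ-≡ below central (ballot 0 (t + t) * suc t) (begin
    central + below                                 ≡⟨ cong (central +_) (choosePred-central t) ⟩
    central + central * t                           ≡⟨ *-suc central t ⟨
    central * suc t                                 ≡⟨ cong (_* suc t) (ballot-formula 0 t) ⟨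
    (ballot 0 (t + t) + choosePred (t + t) t) * suc t ≡⟨ *-distribʳ-+ (suc t) (ballot 0 (t + t)) _ ⟩
    ballot 0 (t + t) * suc t + below                ∎)

-- Products of Catalan numbers

Even : ℕ → Set
Even k = parity k ≡ 0ℙ

even? : Decidable Even
even? k = parity k ≟ℙ 0ℙ

¬even⇒odd : ∀ k → ¬ Even k → parity k ≡ 1ℙ
¬even⇒odd k ¬even with parity k
... | 0ℙ = ⊥-elim (¬even refl)
... | 1ℙ = refl

even⇒half+half : ∀ k → Even k → ⌊ k /2⌋ + ⌊ k /2⌋ ≡ k
even⇒half+half zero _ = refl
even⇒half+half (suc (suc k)) even = cong suc (trans (+-suc ⌊ k /2⌋ ⌊ k /2⌋) (cong suc (even⇒half+half k even)))

half-double : ∀ m → ⌊ m + m /2⌋ ≡ m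
half-double m = sym (n≡⌊n+n/2⌋ m)

double-injective : ∀ {m n} → m + m ≡ n + n → m ≡ n
double-injective {m} {n} eq = trans (sym (half-double m)) (trans (cong ⌊_/2⌋ eq) (half-double n))

noncrossing-odd : ∀ k → parity k ≡ 1ℙ → noncrossing k ≡ 0
noncrossing-odd k odd = matchingsWithin-odd (λ c → c) _ (Ās k) (trans (cong parity (length-replicate k)) odd)

noncrossing-even : ∀ k → Even k → noncrossing k ≡ catalan ⌊ k /2⌋
noncrossing-even k even = begin
  noncrossing k                        ≡⟨ cong noncrossing (even⇒half+half k even) ⟨
  noncrossing (⌊ k /2⌋ + ⌊ k /2⌋)      ≡⟨ noncrossing≡ballot (⌊ k /2⌋ + ⌊ k /2⌋) ⟩
  ballot 0 (⌊ k /2⌋ + ⌊ k /2⌋)         ≡⟨ catalan≡ballot ⌊ k /2⌋ ⟨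
  catalan ⌊ k /2⌋                      ∎

noncrossing≤catalan : ∀ k → noncrossing k ≤ catalan ⌊ k /2⌋
noncrossing≤catalan k with even? k
... | yes even = ≤-reflexive (noncrossing-even k even)
... | no ¬even = ≤-trans (≤-reflexive (noncrossing-odd k (¬even⇒odd k ¬even))) z≤n

halves : Profile → List ℕ
halves e = map ⌊_/2⌋ (regions e)

catalanEntry : Profile → Σ ℕ (Vec ℕ)
catalanEntry e = length (halves e) , fromList (halves e)

prod-noncrossing-even : ∀ l → All Even l → prod (map noncrossing l) ≡ prod (map catalan (map ⌊_/2⌋ l))
prod-noncrossing-even [] [] = refl
prod-noncrossing-even (k ∷ l) (even ∷ evens) = cong₂ _*_ (noncrossing-even k even) (prod-noncrossing-even l evens)

prod-noncrossing-odd : ∀ l → Any (¬_ ∘ Even) l → prod (map noncrossing l) ≡ 0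
prod-noncrossing-odd (k ∷ l) (here ¬even) = cong (_* prod (map noncrossing l)) (noncrossing-odd k (¬even⇒odd k ¬even))
prod-noncrossing-odd (k ∷ l) (there odd) = trans (cong (noncrossing k *_) (prod-noncrossing-odd l odd)) (*-zeroʳ (noncrossing k))

weight-even : ∀ e → All Even (regions e) → weight 0 e ≡ catProd (proj₂ (catalanEntry e))
weight-even e evens = trans (prod-noncrossing-even (regions e) evens)
                            (cong (prod ∘ map catalan) (sym (toList∘fromList (halves e))))

weight-odd : ∀ e → ¬ All Even (regions e) → weight 0 e ≡ 0
weight-odd e ¬evens = prod-noncrossing-odd (regions e) (All.¬All⇒Any¬ even? (regions e) ¬evens)

sum-halves : ∀ l → All Even l → sum (map ⌊_/2⌋ l) + sum (map ⌊_/2⌋ l) ≡ sum l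
sum-halves [] [] = refl
sum-halves (k ∷ l) (even ∷ evens) = begin
  (⌊ k /2⌋ + sum (map ⌊_/2⌋ l)) + (⌊ k /2⌋ + sum (map ⌊_/2⌋ l))
    ≡⟨ +-interchange ⌊ k /2⌋ _ _ _ ⟩
  (⌊ k /2⌋ + ⌊ k /2⌋) + (sum (map ⌊_/2⌋ l) + sum (map ⌊_/2⌋ l))
    ≡⟨ cong₂ _+_ (even⇒half+half k even) (sum-halves l evens) ⟩
  k + sum l ∎

catalanEntry-conditions : ∀ {a b n} e → Shape a b e → All Even (regions e) → a + b ≡ n + n →
  1 ≤ proj₁ (catalanEntry e) × proj₁ (catalanEntry e) ≤ suc ⌊ a /2⌋ × vsum (proj₂ (catalanEntry e)) ≡ n ∸ ⌊ a /2⌋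
catalanEntry-conditions {a} {b} {n} e@(outer , inner) (inner≡ , total≡) evens a+b≡ = s≤s z≤n , length≤ , vsum≡
  where
  t = ⌊ a /2⌋
  S = sum (halves e)
  t≡ : t ≡ length inner
  t≡ = trans (cong ⌊_/2⌋ (sym inner≡)) (half-double (length inner))
  length≤ : length (halves e) ≤ suc t
  length≤ = ≤-reflexive (trans (length-map ⌊_/2⌋ (regions e)) (cong suc (sym t≡)))
  S+t≡n : S + t ≡ n
  S+t≡n = double-injective (begin
    (S + t) + (S + t)   ≡⟨ +-interchange S t S t ⟩
    (S + S) + (t + t)   ≡⟨ cong₂ _+_ (trans (sum-halves (regions e) evens) total≡) (trans (cong (λ l → l + l) t≡) inner≡) ⟩
    b + a               ≡⟨ +-comm b a ⟩
    a + b               ≡⟨ a+b≡ ⟩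
    n + n               ∎)
  vsum≡ : vsum (fromList (halves e)) ≡ n ∸ t
  vsum≡ = begin
    sum (toList (fromList (halves e)))  ≡⟨ cong sum (toList∘fromList (halves e)) ⟩
    S                                   ≡⟨ m+n∸n≡m S t ⟨
    S + t ∸ t                           ≡⟨ cong (_∸ t) S+t≡n ⟩
    n ∸ t                               ∎

CatalanDecomposition : ℕ → ℕ → Set
CatalanDecomposition n k = ∃[ t ] (2 * t ≤ n × ∃[ h ] (h ≤ catalan t ×
  Σ (List (Σ ℕ (Vec ℕ))) λ ps →
    length ps ≡ h ×
    All (λ js → 1 ≤ proj₁ js × proj₁ js ≤ suc t × vsum (proj₂ js) ≡ n ∸ t) ps ×
    k ≡ sum (map (λ js → catProd (proj₂ js)) ps)))

sameMatchings-decomposition : ∀ n u → numA u + numĀ u ≡ n + n → numA u ≤ n →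
                              CatalanDecomposition n (sameMatchings u)
sameMatchings-decomposition n u a+b≡ a≤n =
  t , 2t≤n , length entries , length≤ , entries , refl , conditions , sum≡
  where
  a = numA u
  t = ⌊ a /2⌋
  profiles = profilesWithin (length u) u
  evenRegions? = All.all? even? ∘ regions
  evenProfiles = filter evenRegions? profiles
  shapes = profilesWithin-Shape (length u) u ≤-refl
  entries = map catalanEntry evenProfiles
  2t≤n : 2 * t ≤ n
  2t≤n = ≤-trans (+-monoʳ-≤ t (≤-trans (≤-reflexive (+-identityʳ t)) (⌊n/2⌋≤⌈n/2⌉ a)))
                 (≤-trans (≤-reflexive (⌊n/2⌋+⌈n/2⌉≡n a)) a≤n)
  length≤ : length entries ≤ catalan t
  length≤ = ≤-trans (≤-reflexive (length-map catalanEntry evenProfiles))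
            (≤-trans (length-filter evenRegions? profiles)
            (≤-trans (≤-reflexive (length-profilesWithin (length u) u ≤-refl)) (noncrossing≤catalan a)))
  conditions : All (λ js → 1 ≤ proj₁ js × proj₁ js ≤ suc t × vsum (proj₂ js) ≡ n ∸ t) entries
  conditions = All.map⁺ (All.map (λ (shape , evens) → catalanEntry-conditions _ shape evens a+b≡)
    (All.zipWith (λ x → x) (All.filter⁺ evenRegions? shapes , All.all-filter evenRegions? profiles)))
  sum≡ : sameMatchings u ≡ sum (map (λ js → catProd (proj₂ js)) entries)
  sum≡ = begin
    sameMatchings u                               ≡⟨ sameMatchings-profiles u 0 ⟩
    sum (map (weight 0) profiles)                 ≡⟨ sum-filter evenRegions? (weight 0) weight-odd profiles ⟨
    sum (map (weight 0) evenProfiles)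
      ≡⟨ cong sum (map-cong-local (All.map (λ {e} → weight-even e) (All.all-filter evenRegions? profiles))) ⟩
    sum (map (λ e → catProd (proj₂ (catalanEntry e))) evenProfiles)
      ≡⟨ cong sum (map-∘ evenProfiles) ⟩
    sum (map (λ js → catProd (proj₂ js)) entries) ∎

balanced-alternation : ∀ n w → length w ≡ n + n → Σ Parity λ p → numA (alternate p w) ≤ n
balanced-alternation n w length≡ with numA (alternate 0ℙ w) ≤? n
... | yes few = 0ℙ , few
... | no many = 1ℙ , +-cancelˡ-≤ n _ _ (≤-trans (+-monoˡ-≤ _ (<⇒≤ (≰⇒> many))) (≤-reflexive (begin
  numA (alternate 0ℙ w) + numA (alternate 1ℙ w)   ≡⟨ cong (numA (alternate 0ℙ w) +_) (numA-alternate-⁻¹ 0ℙ w) ⟩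
  numA (alternate 0ℙ w) + numĀ (alternate 0ℙ w)   ≡⟨ numA+numĀ (alternate 0ℙ w) ⟩
  length (alternate 0ℙ w)                         ≡⟨ length-alternate 0ℙ w ⟩
  length w                                        ≡⟨ length≡ ⟩
  n + n                                           ∎)))

mainTheorem9 : (n k : ℕ) → 1 ≤ n → InR1 n k →
    ∃[ t ] (2 * t ≤ n × ∃[ h ] (h ≤ catalan t ×
      Σ (List (Σ ℕ (Vec ℕ))) λ ps →
        length ps ≡ h ×
        All (λ js → 1 ≤ proj₁ js × proj₁ js ≤ suc t × vsum (proj₂ js) ≡ n ∸ t) ps ×
        k ≡ sum (map (λ js → catProd (proj₂ js)) ps)))
mainTheorem9 n k _ (w , exactly-k) = subst (CatalanDecomposition n) (sym k≡) decomposition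
  where
  u = toList w
  length≡ : length u ≡ n + n
  length≡ = trans (length-toList w) (cong (n +_) (+-identityʳ n))
  p = proj₁ (balanced-alternation n u length≡)
  v = alternate p u
  k≡ : k ≡ sameMatchings v
  k≡ = trans (validTrees-count n w k exactly-k) (matchings-alternate u p)
  decomposition : CatalanDecomposition n (sameMatchings v)
  decomposition = sameMatchings-decomposition n v
    (trans (numA+numĀ v) (trans (length-alternate p u) length≡)) (proj₂ (balanced-alternation n u length≡))
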